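{- Let $a$ be a positive integer. Then $B_a$, viewed as a map on the integers $\ge 2$, has only finitely many cycles, and for every integer $n\ge2$ the sequence of iterates $n, B_a(n), B_a^2(n),\dots$ eventually enters a cycle.
   Context: For an integer $n\ge 2$ with prime factorization $n=p_1^{r_1}\cdots p_k^{r_k}$, let $B(n)=\sum_{i=1}^k r_ip_i$. For a positive integer $a$, define $B_a(n)=n+a$ if $n$ is prime and $B_a(n)=B(n)$ otherwise; $B_a$ maps integers $\ge2$ to integers $\ge2$, and $B_a^k$ denotes its $k$-fold iterate. A point $m$ is periodic if $B_a^l(m)=m$ for some $l\ge 1$, and a cycle is the orbit of a periodic point. -}

module Defs where

open import Data.Nat using (ℕ; zero; suc; _+_; _*_; _≤_; _≤?_)
open import Data.Nat.DivMod using (_/_)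
open import Data.Nat.Divisibility using (_∣?_)
open import Data.Nat.Primality using (Prime; prime?)
open import Data.Product using (Σ; ∃; _×_)
open import Relation.Nullary using (yes; no)
open import Relation.Binary.PropositionalEquality using (_≡_)

-- Trial division: sopfrAux fuel n k sums, with multiplicity, the prime factors
-- of n that are ≥ k+2 (called with k = 0, every divisor found first is prime).
sopfrAux : ℕ → ℕ → ℕ → ℕ
sopfrAux zero n k = 0
sopfrAux (suc f) n k with n ≤? 1
... | yes _ = 0
... | no _ with suc (suc k) ∣? n
...   | yes _ = suc (suc k) + sopfrAux f (n / suc (suc k)) k
...   | no _  = sopfrAux f n (suc k)

-- B(n) = Σ r_i p_i for n = p_1^{r_1} ⋯ p_k^{r_k}  (fuel 2n suffices; B(1) = 0)
B : ℕ → ℕ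
B n = sopfrAux (2 * n) n 0

Ba : ℕ → ℕ → ℕ
Ba a n with prime? n
... | yes _ = n + a
... | no _  = B n

iter : (ℕ → ℕ) → ℕ → ℕ → ℕ
iter f zero m = m
iter f (suc k) m = iter f k (f m)

Periodic : ℕ → ℕ → Set
Periodic a m = Σ ℕ λ l → (1 ≤ l) × (iter (Ba a) l m ≡ m)

{-# OPTIONS --safe #-}
-- For composite n = p e with p prime and e ≥ 2, B(n) = p + B(e) ≤ p + e, hence 2 B(n) ≤ n + 4.
-- Above M = a² + a + 4 the map B_a therefore descends within a + 1 steps: from x > M it
-- adds a while the current value x + j a is prime, and x + j a is a proper multiple of
-- a + 1 for j = x mod (a + 1); at the first composite value, B(x + j a) ≤ (x + a² + 4)/2 < x.
-- So every orbit returns to [0, M] infinitely often. Two of these returns hit the same value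
-- (pigeonhole), which gives a periodic point on the orbit; and since every cycle meets
-- [0, M], the periodic points eventually reached from 0, …, M represent all cycles.
module Submission where

open import Defs
open import Data.Nat
open import Data.Nat.Properties
open import Data.Nat.DivMod using (_/_; _%_; m*[n/m]≡n; m≡m%n+[m/n]*n; m%n<n)
open import Data.Nat.Divisibility using (_∣_; _∣?_; divides; ∣⇒≤; hasNonTrivialDivisor)
open import Data.Nat.Primality
open import Data.Nat.Induction using (<-rec)
open import Data.Nat.Tactic.RingSolver using (solve)
open import Data.Fin using (toℕ; fromℕ<)
open import Data.Fin.Properties using (pigeonhole; toℕ-fromℕ<)
open import Data.List using (List; []; _∷_; applyUpTo; filter)
open import Data.List.Membership.Propositional using (_∈_)
open import Data.List.Membership.Propositional.Properties
  using (∈-applyUpTo⁺; ∈-applyUpTo⁻; ∈-filter⁺; ∈-filter⁻)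
open import Data.Product using (Σ; ∃₂; ∃-syntax; _×_; _,_; proj₁; proj₂)
open import Data.Sum using (inj₁; inj₂)
open import Relation.Nullary using (¬_; yes; no; contradiction)
open import Relation.Binary.PropositionalEquality

PeriodicPoint : (ℕ → ℕ) → ℕ → Set
PeriodicPoint f m = ∃[ l ] 1 ≤ l × iter f l m ≡ m

module _ {f : ℕ → ℕ} where

  iter-+ : ∀ p q x → iter f (p + q) x ≡ iter f q (iter f p x)
  iter-+ zero    q x = refl
  iter-+ (suc p) q x = iter-+ p q (f x)

  iter-suc : ∀ k x → iter f (suc k) x ≡ f (iter f k x)
  iter-suc zero    x = refl
  iter-suc (suc k) x = iter-suc k (f x)

  iter-preserves : (P : ℕ → Set) → (∀ {x} → P x → P (f x)) → ∀ k {x} → P x → P (iter f k x)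
  iter-preserves P step zero    px = px
  iter-preserves P step (suc k) px = iter-preserves P step k (step px)

  iter-*-period : ∀ {l m} → iter f l m ≡ m → ∀ K → iter f (K * l) m ≡ m
  iter-*-period eq zero = refl
  iter-*-period {l} {m} eq (suc K) = begin
    iter f (l + K * l) m         ≡⟨ iter-+ l (K * l) m ⟩
    iter f (K * l) (iter f l m)  ≡⟨ cong (iter f (K * l)) eq ⟩
    iter f (K * l) m             ≡⟨ iter-*-period eq K ⟩
    m                            ∎
    where open ≡-Reasoning

  repetition⇒periodic : ∀ {p q} x → p < q → iter f p x ≡ iter f q x → PeriodicPoint f (iter f p x)
  repetition⇒periodic {p} {q} x p<q eq = q ∸ p , m<n⇒0<n∸m p<q , (begin
    iter f (q ∸ p) (iter f p x)  ≡⟨ iter-+ p (q ∸ p) x ⟨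
    iter f (p + (q ∸ p)) x       ≡⟨ cong (λ r → iter f r x) (m+[n∸m]≡n (<⇒≤ p<q)) ⟩
    iter f q x                   ≡⟨ eq ⟨
    iter f p x                   ∎)
    where open ≡-Reasoning

  periodic⇒orbit-returns : ∀ {m} → PeriodicPoint f m → ∀ j → ∃[ j′ ] iter f j′ (iter f j m) ≡ m
  periodic⇒orbit-returns {m} (suc l , _ , eq) j = j * l , (begin
    iter f (j * l) (iter f j m)  ≡⟨ iter-+ j (j * l) m ⟨
    iter f (j + j * l) m         ≡⟨ cong (λ r → iter f r m) (*-suc j l) ⟨
    iter f (j * suc l) m         ≡⟨ iter-*-period eq j ⟩
    m                            ∎)
    where open ≡-Reasoning

  module _ {M} (descends : ∀ x → M < x → ∃[ k ] 1 ≤ k × iter f k x < x) where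

    descent⇒reaches-≤ : ∀ x → ∃[ k ] iter f k x ≤ M
    descent⇒reaches-≤ = <-rec _ reach
      where
      reach : ∀ x → (∀ {y} → y < x → ∃[ k ] iter f k y ≤ M) → ∃[ k ] iter f k x ≤ M
      reach x rec with x ≤? M
      ... | yes x≤M = 0 , x≤M
      ... | no x≰M with k , _ , below ← descends x (≰⇒> x≰M) with k′ , reached ← rec below =
        k + k′ , subst (_≤ M) (sym (iter-+ k k′ x)) reached

    descent⇒returns : ∀ x → ∃[ k ] 1 ≤ k × iter f k x ≤ M
    descent⇒returns x with k , reached ← descent⇒reaches-≤ (f x) = suc k , s≤s z≤n , reached

bounded⇒collision : ∀ {M} (g : ℕ → ℕ) → (∀ i → g i ≤ M) → ∃₂ λ i j → i < j × g i ≡ g j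
bounded⇒collision {M} g bounded
  with i , j , i<j , eq ← pigeonhole (n<1+n (suc M)) (λ i → fromℕ< (s≤s (bounded (toℕ i)))) =
  toℕ i , toℕ j , i<j ,
  trans (sym (toℕ-fromℕ< (s≤s (bounded (toℕ i)))))
        (trans (cong toℕ eq) (toℕ-fromℕ< (s≤s (bounded (toℕ j)))))

module Recurrent {f : ℕ → ℕ} {M : ℕ} (returns : ∀ x → ∃[ k ] 1 ≤ k × iter f k x ≤ M) where

  returnTime : ℕ → ℕ → ℕ
  returnTime n zero    = 0
  returnTime n (suc i) = returnTime n i + proj₁ (returns (iter f (returnTime n i) n))

  returnTime-≤ : ∀ n i → iter f (returnTime n (suc i)) n ≤ M
  returnTime-≤ n i with k , _ , back ← returns (iter f (returnTime n i) n) =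
    subst (_≤ M) (sym (iter-+ (returnTime n i) k n)) back

  returnTime-<-suc : ∀ n i → returnTime n i < returnTime n (suc i)
  returnTime-<-suc n i = m<m+n (returnTime n i) (proj₁ (proj₂ (returns (iter f (returnTime n i) n))))

  returnTime-< : ∀ n {i j} → i < j → returnTime n i < returnTime n j
  returnTime-< n {i} {suc j} (s≤s i≤j) with m≤n⇒m<n∨m≡n i≤j
  ... | inj₁ i<j  = <-trans (returnTime-< n i<j) (returnTime-<-suc n j)
  ... | inj₂ refl = returnTime-<-suc n i

  eventually-periodic : ∀ n → ∃[ k ] PeriodicPoint f (iter f k n)
  eventually-periodic n
    with i , j , i<j , eq ← bounded⇒collision (λ i → iter f (returnTime n (suc i)) n) (returnTime-≤ n) =
    returnTime n (suc i) , repetition⇒periodic n (returnTime-< n (s≤s i<j)) eq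

  periodicEntry : ℕ → ℕ
  periodicEntry n = iter f (proj₁ (eventually-periodic n)) n

  cycle-representatives :
    Σ (List ℕ) λ C → (∀ c → c ∈ C → PeriodicPoint f c) ×
                     (∀ m → PeriodicPoint f m → ∃[ c ] c ∈ C × ∃[ k ] iter f k c ≡ m)
  cycle-representatives = C , periodic , reached
    where
    C : List ℕ
    C = applyUpTo periodicEntry (suc M)

    periodic : ∀ c → c ∈ C → PeriodicPoint f c
    periodic c c∈C with t , _ , refl ← ∈-applyUpTo⁻ periodicEntry c∈C = proj₂ (eventually-periodic t)

    reached : ∀ m → PeriodicPoint f m → ∃[ c ] c ∈ C × ∃[ k ] iter f k c ≡ m
    reached m per with k , _ , low ← returns m =
      periodicEntry m′ , ∈-applyUpTo⁺ periodicEntry (s≤s low) ,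
      subst (λ c → ∃[ j ] iter f j c ≡ m) (iter-+ k k′ m) (periodic⇒orbit-returns per (k + k′))
      where
      m′ = iter f k m
      k′ = proj₁ (eventually-periodic m′)

+-≤-* : ∀ {d e} → 2 ≤ d → 2 ≤ e → d + e ≤ d * e
+-≤-* {suc (suc x)} {suc (suc y)} (s≤s (s≤s z≤n)) (s≤s (s≤s z≤n)) =
  subst (suc (suc x) + suc (suc y) ≤_) (sym identity) (m≤m+n _ (x + y + x * y))
  where
  identity : suc (suc x) * suc (suc y) ≡ (suc (suc x) + suc (suc y)) + (x + y + x * y)
  identity = solve (x ∷ y ∷ [])

2*[+]≤*+4 : ∀ {d e} → 2 ≤ d → 2 ≤ e → 2 * (d + e) ≤ d * e + 4
2*[+]≤*+4 {suc (suc x)} {suc (suc y)} (s≤s (s≤s z≤n)) (s≤s (s≤s z≤n)) =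
  subst (2 * (suc (suc x) + suc (suc y)) ≤_) (sym identity) (m≤m+n _ (x * y))
  where
  identity : suc (suc x) * suc (suc y) + 4 ≡ 2 * (suc (suc x) + suc (suc y)) + x * y
  identity = solve (x ∷ y ∷ [])

sopfrAux-≤1 : ∀ fuel {n} k → n ≤ 1 → sopfrAux fuel n k ≡ 0
sopfrAux-≤1 zero       k _   = refl
sopfrAux-≤1 (suc fuel) {n} k n≤1 with n ≤? 1
... | yes _   = refl
... | no n≰1 = contradiction n≤1 n≰1

sopfrAux-≤ : ∀ fuel n k → sopfrAux fuel n k ≤ n
sopfrAux-≤ zero       n k = z≤n
sopfrAux-≤ (suc fuel) n k with n ≤? 1
... | yes _ = z≤n
... | no n≰1 with suc (suc k) ∣? n
...   | no _    = sopfrAux-≤ fuel n (suc k)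
...   | yes p∣n = subst (p + sopfrAux fuel e k ≤_) (m*[n/m]≡n p∣n) bound
  where
  p = suc (suc k)
  e = n / p
  bound : p + sopfrAux fuel e k ≤ p * e
  bound with e ≤? 1
  ... | yes e≤1 rewrite sopfrAux-≤1 fuel k e≤1 | +-identityʳ p | m*[n/m]≡n p∣n =
    ∣⇒≤ ⦃ ≢-nonZero (λ { refl → n≰1 z≤n }) ⦄ p∣n
  ... | no e≰1 = ≤-trans (+-monoʳ-≤ p (sopfrAux-≤ fuel e k)) (+-≤-* (s≤s (s≤s z≤n)) (≰⇒> e≰1))

-- The divisor d makes trial division find a factor p ≤ d before the fuel runs out, and
-- forces n / p ≥ 2.
sopfrAux-composite : ∀ fuel n k d → suc (suc k) ≤ d → d < n → d ∣ n → n ≤ fuel + k →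
                     2 * sopfrAux fuel n k ≤ n + 4
sopfrAux-composite zero n k d k+2≤d d<n _ n≤k =
  contradiction (<-≤-trans d<n (≤-trans n≤k (m≤n+m k 2))) (≤⇒≯ k+2≤d)
sopfrAux-composite (suc fuel) n k d k+2≤d d<n d∣n n≤fuel+k with n ≤? 1
... | yes _ = z≤n
... | no n≰1 with suc (suc k) ∣? n
...   | yes p∣n = subst (λ n → 2 * (p + sopfrAux fuel e k) ≤ n + 4) (m*[n/m]≡n p∣n)
                    (≤-trans (*-monoʳ-≤ 2 (+-monoʳ-≤ p (sopfrAux-≤ fuel e k)))
                             (2*[+]≤*+4 (s≤s (s≤s z≤n)) 2≤e))
  where
  p = suc (suc k)
  e = n / p
  2≤e : 2 ≤ e
  2≤e with e ≤? 1
  ... | no e≰1 = ≰⇒> e≰1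
  ... | yes e≤1 = contradiction (<-≤-trans d<n n≤p) (≤⇒≯ k+2≤d)
    where
    n≤p : n ≤ p
    n≤p = subst (_≤ p) (m*[n/m]≡n p∣n) (subst (p * e ≤_) (*-identityʳ p) (*-monoʳ-≤ p e≤1))
...   | no p∤n = sopfrAux-composite fuel n (suc k) d k+1<d d<n d∣n (subst (n ≤_) (sym (+-suc fuel k)) n≤fuel+k)
  where
  k+1<d : suc (suc (suc k)) ≤ d
  k+1<d with m≤n⇒m<n∨m≡n k+2≤d
  ... | inj₁ lt   = lt
  ... | inj₂ refl = contradiction d∣n p∤n

B-composite : ∀ {n} → 2 ≤ n → ¬ Prime n → 2 * B n ≤ n + 4
B-composite {n} 2≤n ¬prime with ¬prime⇒composite ⦃ n>1⇒nonTrivial 2≤n ⦄ ¬prime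
... | composite {d} d<n d∣n =
  sopfrAux-composite (2 * n) n 0 d (nonTrivial⇒n>1 d) d<n d∣n (subst (n ≤_) (sym (+-identityʳ _)) (m≤m+n n _))

module _ (a : ℕ) where

  Ba-prime : ∀ {n} → Prime n → Ba a n ≡ n + a
  Ba-prime {n} p with prime? n
  ... | yes _ = refl
  ... | no ¬p = contradiction p ¬p

  Ba-¬prime : ∀ {n} → ¬ Prime n → Ba a n ≡ B n
  Ba-¬prime {n} ¬p with prime? n
  ... | yes p = contradiction p ¬p
  ... | no _  = refl

  Ba-≤1 : ∀ {n} → n ≤ 1 → Ba a n ≤ 1
  Ba-≤1 z≤n       = z≤n
  Ba-≤1 (s≤s z≤n) = z≤n

  iter-Ba-reflects-≥2 : ∀ k {c m} → iter (Ba a) k c ≡ m → 2 ≤ m → 2 ≤ c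
  iter-Ba-reflects-≥2 k {c} refl 2≤m with 2 ≤? c
  ... | yes 2≤c = 2≤c
  ... | no 2≰c = contradiction (iter-preserves (_≤ 1) Ba-≤1 k (≤-pred (≰⇒> 2≰c))) (<⇒≱ 2≤m)

  threshold : ℕ
  threshold = a * a + a + 4

  B-shift-< : ∀ {x j} → threshold < x → j ≤ a → ¬ Prime (x + j * a) → B (x + j * a) < x
  B-shift-< {x} {j} M<x j≤a ¬prime = *-cancelˡ-< 2 _ _ (begin-strict
    2 * B (x + j * a)    ≤⟨ B-composite 2≤y ¬prime ⟩
    x + j * a + 4        ≤⟨ +-monoˡ-≤ 4 (+-monoʳ-≤ x (*-monoˡ-≤ a j≤a)) ⟩
    x + a * a + 4        ≡⟨ +-assoc x (a * a) 4 ⟩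
    x + (a * a + 4)      ≤⟨ +-monoʳ-≤ x (+-monoˡ-≤ 4 (m≤m+n (a * a) a)) ⟩
    x + threshold        <⟨ +-monoʳ-< x M<x ⟩
    x + x                ≡⟨ cong (x +_) (+-identityʳ x) ⟨
    2 * x                ∎)
    where
    open ≤-Reasoning
    2≤y : 2 ≤ x + j * a
    2≤y = ≤-trans (≤-trans (s≤s (s≤s z≤n)) (m≤n+m 4 (a * a + a)))
                  (≤-trans (<⇒≤ M<x) (m≤m+n x (j * a)))

  -- a ≡ −1 (mod a + 1), so adding x mod (a + 1) copies of a to x reaches a multiple of a + 1.
  1+a∣shift : ∀ x → suc a ∣ x + x % suc a * a
  1+a∣shift x = divides (x / suc a + x % suc a) (begin
    x + x % suc a * a                          ≡⟨ cong (_+ x % suc a * a) (m≡m%n+[m/n]*n x (suc a)) ⟩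
    x % suc a + x / suc a * suc a + x % suc a * a  ≡⟨ regroup (x % suc a) (x / suc a) a ⟩
    (x / suc a + x % suc a) * suc a            ∎)
    where
    open ≡-Reasoning
    regroup : ∀ i q a → i + q * suc a + i * a ≡ (q + i) * suc a
    regroup i q a = solve (i ∷ q ∷ a ∷ [])

  shift-¬prime : 1 ≤ a → ∀ {x} → suc a < x → ¬ Prime (x + x % suc a * a)
  shift-¬prime 1≤a {x} a<x = composite⇒¬prime
    (hasNonTrivialDivisor ⦃ n>1⇒nonTrivial (s≤s 1≤a) ⦄ (≤-trans a<x (m≤m+n x _)) (1+a∣shift x))

  module _ {x} (M<x : threshold < x) where

    descends-at : ∀ {j} → j ≤ a → ¬ Prime (x + j * a) → iter (Ba a) j x ≡ x + j * a →
           ∃[ k ] 1 ≤ k × iter (Ba a) k x < x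
    descends-at {j} j≤a ¬p at-j = suc j , s≤s z≤n , (begin-strict
      iter (Ba a) (suc j) x    ≡⟨ iter-suc j x ⟩
      Ba a (iter (Ba a) j x)   ≡⟨ cong (Ba a) at-j ⟩
      Ba a (x + j * a)         ≡⟨ Ba-¬prime ¬p ⟩
      B (x + j * a)            <⟨ B-shift-< M<x j≤a ¬p ⟩
      x                        ∎)
      where open ≤-Reasoning

    descends-after-run : ∀ j t → j + t ≤ a → ¬ Prime (x + (j + t) * a) →
                         iter (Ba a) j x ≡ x + j * a →
            ∃[ k ] 1 ≤ k × iter (Ba a) k x < x
    descends-after-run j zero j+0≤a ¬p at-j =
      descends-at (subst (_≤ a) (+-identityʳ j) j+0≤a)
                  (subst (λ s → ¬ Prime (x + s * a)) (+-identityʳ j) ¬p) at-j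
    descends-after-run j (suc t) j+t≤a ¬p at-j with prime? (x + j * a)
    ... | no ¬pj = descends-at (≤-trans (m≤m+n j (suc t)) j+t≤a) ¬pj at-j
    ... | yes pj = descends-after-run (suc j) t (subst (_≤ a) (+-suc j t) j+t≤a)
                     (subst (λ s → ¬ Prime (x + s * a)) (+-suc j t) ¬p) (begin
      iter (Ba a) (suc j) x    ≡⟨ iter-suc j x ⟩
      Ba a (iter (Ba a) j x)   ≡⟨ cong (Ba a) at-j ⟩
      Ba a (x + j * a)         ≡⟨ Ba-prime pj ⟩
      x + j * a + a            ≡⟨ +-assoc x (j * a) a ⟩
      x + (j * a + a)          ≡⟨ cong (x +_) (+-comm (j * a) a) ⟩
      x + suc j * a            ∎)
      where open ≡-Reasoning

  Ba-descends : 1 ≤ a → ∀ x → threshold < x → ∃[ k ] 1 ≤ k × iter (Ba a) k x < x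
  Ba-descends 1≤a x M<x =
    descends-after-run M<x 0 (x % suc a) (≤-pred (m%n<n x (suc a))) (shift-¬prime 1≤a a<x) (sym (+-identityʳ x))
    where
    a<x : suc a < x
    a<x = ≤-<-trans (≤-trans (s≤s (m≤n+m a (a * a))) (m<m+n (a * a + a) z<s)) M<x

theorem3p4 : (a : ℕ) → 1 ≤ a →
    (Σ (List ℕ) λ C →
      ((c : ℕ) → c ∈ C → (2 ≤ c) × Periodic a c) ×
      ((m : ℕ) → 2 ≤ m → Periodic a m →
        Σ ℕ λ c → (c ∈ C) × (Σ ℕ λ k → iter (Ba a) k c ≡ m)))
    ×
    ((n : ℕ) → 2 ≤ n → Σ ℕ λ k → Periodic a (iter (Ba a) k n))
-- Representatives below 2 are discarded: B_a maps 0 and 1 to 0, so their orbits never reach 2.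
theorem3p4 a 1≤a = (filter (2 ≤?_) C , periodic≥2 , reach≥2) , λ n _ → eventually-periodic n
  where
  open Recurrent {Ba a} {threshold a} (descent⇒returns (Ba-descends a 1≤a))

  C : List ℕ
  C = proj₁ cycle-representatives

  periodic≥2 : ∀ c → c ∈ filter (2 ≤?_) C → 2 ≤ c × Periodic a c
  periodic≥2 c c∈ = let c∈C , 2≤c = ∈-filter⁻ (2 ≤?_) c∈ in
    2≤c , proj₁ (proj₂ cycle-representatives) c c∈C

  reach≥2 : ∀ m → 2 ≤ m → Periodic a m → ∃[ c ] c ∈ filter (2 ≤?_) C × ∃[ k ] iter (Ba a) k c ≡ m
  reach≥2 m 2≤m per = let c , c∈C , k , eq = proj₂ (proj₂ cycle-representatives) m per in
    c , ∈-filter⁺ (2 ≤?_) c∈C (iter-Ba-reflects-≥2 a k eq 2≤m) , k , eq
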